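{- Let $\delta=6\in\mathbb{F}_{13}$ and let $\alpha\in\mathbb{F}_{13^2}$ be a root of $x^2-\delta$. Let $C_{13}^B=\{0,1,3,4\}\cup\{7(\alpha+1),2(\alpha+1),7(\alpha+7)\}$. For $s\in S$ and $\gamma\in\mathbb{F}_{13^2}$ put $C_{s,\gamma}=\{sx+\gamma : x\in C_{13}^B\}$. Then the orbit of $C_{13}^B$ under $\mathrm{Aut}(P(13^2))$ equals $\{C_{s,\gamma} : s\in S,\ \gamma\in\mathbb{F}_{13^2}\}$.
   Context: $S$ is the set of nonzero squares of $\mathbb{F}_{13^2}$. The Paley graph $P(13^2)$ has vertex set $\mathbb{F}_{13^2}$, two distinct vertices adjacent iff their difference lies in $S$. $\mathrm{Aut}(P(13^2))=\{\gamma\mapsto a\gamma^{v}+b : a\in S,\ b\in\mathbb{F}_{13^2},\ v\in\mathrm{Gal}(\mathbb{F}_{13^2})\}$, acting on subsets elementwise. Elements of $\mathbb{F}_{13}$ are written as integers mod $13$. -}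

module Defs where

open import Data.Nat using (ℕ; _∸_) renaming (_+_ to _+ℕ_; _*_ to _*ℕ_)
open import Data.Nat.DivMod using (_mod_)
open import Data.Fin using (Fin; toℕ)
open import Data.Product using (_×_; _,_; Σ; ∃; ∃-syntax)
open import Data.List using (List; []; _∷_)
open import Data.List.Membership.Propositional using (_∈_)
open import Relation.Binary.PropositionalEquality using (_≡_)
open import Relation.Nullary using (¬_)
open import Function using (_⇔_)
open import Function.Definitions using (Bijective)
open import Relation.Binary.PropositionalEquality using (_≡_)

F13 : Set
F13 = Fin 13

infixl 6 _+₁₃_
infixl 7 _*₁₃_
_+₁₃_ : F13 → F13 → F13
a +₁₃ b = (toℕ a +ℕ toℕ b) mod 13

_*₁₃_ : F13 → F13 → F13
a *₁₃ b = (toℕ a *ℕ toℕ b) mod 13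

-₁₃_ : F13 → F13
-₁₃ a = (13 ∸ toℕ a) mod 13

-- δ = 6 ∈ F_13 (a non-square mod 13, so x² - 6 is irreducible)
δ : F13
δ = 6 mod 13

-- F_{13^2} = F_13[t]/(t² - δ); the pair (a , b) stands for a + b t.
F169 : Set
F169 = F13 × F13

infixl 6 _+_
infixl 7 _*_
_+_ : F169 → F169 → F169
(a , b) + (c , d) = (a +₁₃ c , b +₁₃ d)

_*_ : F169 → F169 → F169
(a , b) * (c , d) = (a *₁₃ c +₁₃ δ *₁₃ (b *₁₃ d) , a *₁₃ d +₁₃ b *₁₃ c)

-_ : F169 → F169
- (a , b) = (-₁₃ a , -₁₃ b)

ι : F13 → F169
ι a = (a , 0 mod 13)

lit : ℕ → F169
lit n = ι (n mod 13)

𝟘 𝟙 : F169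
𝟘 = lit 0
𝟙 = lit 1

S : F169 → Set
S x = ∃[ y ] (¬ (y ≡ 𝟘) × (y * y ≡ x))

record Gal : Set where
  field
    σ      : F169 → F169
    σ-bij  : Bijective _≡_ _≡_ σ
    σ-+    : ∀ x y → σ (x + y) ≡ σ x + σ y
    σ-*    : ∀ x y → σ (x * y) ≡ σ x * σ y
    σ-𝟙    : σ 𝟙 ≡ 𝟙
open Gal public

Subset : Set₁
Subset = F169 → Set

_≐_ : Subset → Subset → Set
A ≐ B = ∀ x → (A x ⇔ B x)

image : (F169 → F169) → List F169 → Subset
image f C x = ∃[ c ] (c ∈ C × x ≡ f c)

CB : F169 → List F169
CB α = lit 0 ∷ lit 1 ∷ lit 3 ∷ lit 4
     ∷ lit 7 * (α + 𝟙) ∷ lit 2 * (α + 𝟙) ∷ lit 7 * (α + lit 7) ∷ []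

-- T lies in the orbit of C under Aut(P(13^2)) = {γ ↦ a γ^v + b}
InOrbit : F169 → Subset → Set
InOrbit α T = ∃[ a ] ∃[ b ] Σ Gal λ v →
  S a × (T ≐ image (λ γ → a * σ v γ + b) (CB α))

InFamily : F169 → Subset → Set
InFamily α T = ∃[ s ] ∃[ γ ] (S s × (T ≐ image (λ x → s * x + γ) (CB α)))

-- An automorphism γ ↦ a γ^v + b with v trivial maps C_13^B to C_{a,b} directly.  The only
-- other field automorphism is conjugation a + b√δ ↦ a − b√δ: it fixes F_13, hence is
-- determined by the image of √δ, which must again be a square root of δ.  Conjugation sends
-- α to −α, and on C_13^B it acts as the reflection x ↦ 4 − x, so a C^v + b = C_{−a, 4a+b};
-- finally −a ∈ S because −1 = 5² is already a square in F_13.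
module Submission where

open import Defs
open import Relation.Binary.PropositionalEquality using (_≡_)
open import Function using (_⇔_)

open import Data.Nat using (ℕ; zero; suc)
open import Data.Nat.DivMod using (_mod_)
open import Data.Fin using (toℕ) renaming (_≟_ to _≟₁₃_)
import Data.Fin.Properties as Fin
open import Data.Product using (_,_; proj₁; proj₂)
open import Data.Product.Properties using (≡-dec)
open import Data.Sum using (_⊎_; inj₁; inj₂)
import Data.Sum as Sum
open import Data.List using (List; map)
open import Data.List.Membership.Propositional using (_∈_)
open import Data.List.Membership.Propositional.Properties using (∈-map⁺; ∈-map⁻)
open import Data.List.Relation.Unary.All using (All; all?) renaming (lookup to All-lookup)
open import Function using (_∘_; mk⇔; Equivalence)
open import Function.Construct.Composition using (_⇔-∘_)
open import Function.Construct.Symmetry using (⇔-sym)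
open import Relation.Binary.Definitions using (DecidableEquality)
open import Relation.Binary.PropositionalEquality using (refl; sym; trans; cong; cong₂; module ≡-Reasoning)
open import Relation.Nullary using (Dec)
open import Relation.Nullary.Decidable using (True; toWitness; from-yes; map′; _→-dec_; _⊎-dec_)

infix 4 _≟_
_≟_ : DecidableEquality F169
_≟_ = ≡-dec _≟₁₃_ _≟₁₃_

open import Data.List.Relation.Binary.Subset.DecPropositional _≟_ using (_⊆_; _⊆?_)

all-F169? : {P : F169 → Set} → ((x : F169) → Dec (P x)) → Dec (∀ x → P x)
all-F169? P? = map′ (λ h x → h (proj₁ x) (proj₂ x)) (λ h a b → h (a , b))
  (Fin.all? λ a → Fin.all? λ b → P? (a , b))

√δ : F169
√δ = (0 mod 13 , 1 mod 13)

conj : F169 → F169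
conj (a , b) = (a , -₁₃ b)

affine : F169 → F169 → F169 → F169
affine s γ x = s * x + γ

reflection : F169 → F169
reflection = affine (- 𝟙) (lit 4)

_·𝟙 : ℕ → F169
zero  ·𝟙 = 𝟘
suc n ·𝟙 = 𝟙 + n ·𝟙

≐-trans : ∀ {A B C} → A ≐ B → B ≐ C → A ≐ C
≐-trans A≐B B≐C x = B≐C x ⇔-∘ A≐B x

module _ {L : List F169} where

  image-cong : ∀ {f g} → (∀ {c} → c ∈ L → f c ≡ g c) → image f L ≐ image g L
  image-cong f≗g x = mk⇔
    (λ { (c , c∈L , refl) → c , c∈L , f≗g c∈L })
    (λ { (c , c∈L , refl) → c , c∈L , sym (f≗g c∈L) })

  image-∘ : ∀ h {f g} → image f L ≐ image g L → image (h ∘ f) L ≐ image (h ∘ g) L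
  image-∘ h f≐g x = mk⇔ (along f≐g) (along (⇔-sym ∘ f≐g))
    where
    along : ∀ {f g} → image f L ≐ image g L → image (h ∘ f) L x → image (h ∘ g) L x
    along {f} f≐g (c , c∈L , refl) with Equivalence.to (f≐g (f c)) (c , c∈L , refl)
    ... | c′ , c′∈L , fc≡gc′ = c′ , c′∈L , cong h fc≡gc′

  image-≐ : ∀ {f g} → map f L ⊆ map g L → map g L ⊆ map f L → image f L ≐ image g L
  image-≐ f⊆g g⊆f x = mk⇔ (included f⊆g) (included g⊆f)
    where
    included : ∀ {f g} → map f L ⊆ map g L → image f L x → image g L x
    included {f} {g} f⊆g (c , c∈L , refl) = ∈-map⁻ g (f⊆g (∈-map⁺ f c∈L))

square-roots-of-δ : ∀ y → y * y ≡ ι δ → y ≡ √δ ⊎ y ≡ - √δ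
square-roots-of-δ = from-yes (all-F169? λ y → y * y ≟ ι δ →-dec (y ≟ √δ ⊎-dec y ≟ - √δ))

x≡x+x⇒x≡𝟘 : ∀ x → x ≡ x + x → x ≡ 𝟘
x≡x+x⇒x≡𝟘 = from-yes (all-F169? λ x → x ≟ x + x →-dec x ≟ 𝟘)

ι≡·𝟙 : ∀ p → ι p ≡ toℕ p ·𝟙
ι≡·𝟙 = from-yes (Fin.all? λ p → ι p ≟ toℕ p ·𝟙)

basis-expansion : ∀ x → x ≡ ι (proj₁ x) + ι (proj₂ x) * √δ
basis-expansion = from-yes (all-F169? λ x → x ≟ ι (proj₁ x) + ι (proj₂ x) * √δ)

conj-expansion : ∀ x → conj x ≡ ι (proj₁ x) + ι (proj₂ x) * - √δ
conj-expansion = from-yes (all-F169? λ x → conj x ≟ ι (proj₁ x) + ι (proj₂ x) * - √δ)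

+-assoc : ∀ x y z → (x + y) + z ≡ x + (y + z)
+-assoc (a , b) (c , d) (e , f) = cong₂ _,_ (+₁₃-assoc a c e) (+₁₃-assoc b d f)
  where
  +₁₃-assoc : ∀ a b c → (a +₁₃ b) +₁₃ c ≡ a +₁₃ (b +₁₃ c)
  +₁₃-assoc = from-yes (Fin.all? λ a → Fin.all? λ b → Fin.all? λ c →
    (a +₁₃ b) +₁₃ c ≟₁₃ a +₁₃ (b +₁₃ c))

on-roots-of-δ : (P : F169 → Set) → P √δ → P (- √δ) → ∀ α → α * α ≡ ι δ → P α
on-roots-of-δ P p₊ p₋ α α² = by-cases (square-roots-of-δ α α²)
  where
  by-cases : α ≡ √δ ⊎ α ≡ - √δ → P α
  by-cases (inj₁ refl) = p₊
  by-cases (inj₂ refl) = p₋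

module _ (v : Gal) where

  σ-𝟘 : σ v 𝟘 ≡ 𝟘
  σ-𝟘 = x≡x+x⇒x≡𝟘 (σ v 𝟘) (σ-+ v 𝟘 𝟘)

  σ-·𝟙 : ∀ n → σ v (n ·𝟙) ≡ n ·𝟙
  σ-·𝟙 zero    = σ-𝟘
  σ-·𝟙 (suc n) = trans (σ-+ v 𝟙 (n ·𝟙)) (cong₂ _+_ (σ-𝟙 v) (σ-·𝟙 n))

  σ-ι : ∀ p → σ v (ι p) ≡ ι p
  σ-ι p = trans (cong (σ v) (ι≡·𝟙 p)) (trans (σ-·𝟙 (toℕ p)) (sym (ι≡·𝟙 p)))

  σ-expansion : ∀ {r} → σ v √δ ≡ r → ∀ x → σ v x ≡ ι (proj₁ x) + ι (proj₂ x) * r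
  σ-expansion {r} √δ↦r x@(a , b) = begin
    σ v x                            ≡⟨ cong (σ v) (basis-expansion x) ⟩
    σ v (ι a + ι b * √δ)             ≡⟨ σ-+ v (ι a) (ι b * √δ) ⟩
    σ v (ι a) + σ v (ι b * √δ)       ≡⟨ cong (σ v (ι a) +_) (σ-* v (ι b) √δ) ⟩
    σ v (ι a) + σ v (ι b) * σ v √δ   ≡⟨ cong₂ (λ p q → p + q * σ v √δ) (σ-ι a) (σ-ι b) ⟩
    ι a + ι b * σ v √δ               ≡⟨ cong (λ q → ι a + ι b * q) √δ↦r ⟩
    ι a + ι b * r                    ∎
    where open ≡-Reasoning

  σ-√δ : σ v √δ ≡ √δ ⊎ σ v √δ ≡ - √δ
  σ-√δ = square-roots-of-δ (σ v √δ) (trans (sym (σ-* v √δ √δ)) (σ-ι δ))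

  σ≗id⊎σ≗conj : (∀ x → σ v x ≡ x) ⊎ (∀ x → σ v x ≡ conj x)
  σ≗id⊎σ≗conj = Sum.map
    (λ fixes x → trans (σ-expansion fixes x) (sym (basis-expansion x)))
    (λ negates x → trans (σ-expansion negates x) (sym (conj-expansion x)))
    σ-√δ

Gal-id : Gal
Gal-id = record
  { σ = λ x → x ; σ-bij = (λ eq → eq) , (λ y → y , λ eq → eq)
  ; σ-+ = λ _ _ → refl ; σ-* = λ _ _ → refl ; σ-𝟙 = refl }

S-*-𝟙 : ∀ {a} → S a → S (a * - 𝟙)
S-*-𝟙 (y , y≢𝟘 , refl) = y * lit 5 , y≢𝟘 ∘ y*5≡𝟘⇒y≡𝟘 y , sym (y²*-𝟙≡[y*5]² y)
  where
  y²*-𝟙≡[y*5]² : ∀ y → (y * y) * - 𝟙 ≡ (y * lit 5) * (y * lit 5)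
  y²*-𝟙≡[y*5]² = from-yes (all-F169? λ y → (y * y) * - 𝟙 ≟ (y * lit 5) * (y * lit 5))
  y*5≡𝟘⇒y≡𝟘 : ∀ y → y * lit 5 ≡ 𝟘 → y ≡ 𝟘
  y*5≡𝟘⇒y≡𝟘 = from-yes (all-F169? λ y → y * lit 5 ≟ 𝟘 →-dec y ≟ 𝟘)

conj-CB≐reflection-CB : ∀ α → α * α ≡ ι δ → image conj (CB α) ≐ image reflection (CB α)
conj-CB≐reflection-CB = on-roots-of-δ (λ α → image conj (CB α) ≐ image reflection (CB α))
  (at √δ) (at (- √δ))
  where
  at : ∀ α {conj⊆ : True (map conj (CB α) ⊆? map reflection (CB α))}
           {⊆conj : True (map reflection (CB α) ⊆? map conj (CB α))} →
       image conj (CB α) ≐ image reflection (CB α)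
  at α {conj⊆} {⊆conj} = image-≐ (toWitness conj⊆) (toWitness ⊆conj)

-- Distributivity is checked by enumeration, hence only on the points of C_13^B.
affine∘reflection-CB : ∀ α → α * α ≡ ι δ → ∀ a b {c} → c ∈ CB α →
  affine a b (reflection c) ≡ affine (a * - 𝟙) (a * lit 4 + b) c
affine∘reflection-CB α α² a b {c} c∈CB = begin
  a * reflection c + b              ≡⟨ cong (_+ b) (All-lookup distrib c∈CB a) ⟩
  (a * - 𝟙) * c + a * lit 4 + b     ≡⟨ +-assoc ((a * - 𝟙) * c) (a * lit 4) b ⟩
  (a * - 𝟙) * c + (a * lit 4 + b)   ∎
  where
  open ≡-Reasoning
  Distributes : F169 → Set
  Distributes c = ∀ a → a * reflection c ≡ (a * - 𝟙) * c + a * lit 4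
  distributes? : ∀ c → Dec (Distributes c)
  distributes? c = all-F169? λ a → a * reflection c ≟ (a * - 𝟙) * c + a * lit 4
  distrib : All Distributes (CB α)
  distrib = on-roots-of-δ (All Distributes ∘ CB)
    (from-yes (all? distributes? (CB √δ))) (from-yes (all? distributes? (CB (- √δ)))) α α²

conj-image-CB : ∀ α → α * α ≡ ι δ → ∀ a b →
  image (affine a b ∘ conj) (CB α) ≐ image (affine (a * - 𝟙) (a * lit 4 + b)) (CB α)
conj-image-CB α α² a b =
  ≐-trans (image-∘ (affine a b) (conj-CB≐reflection-CB α α²))
          (image-cong (affine∘reflection-CB α α² a b))

lemma3p6 : (α : F169) → α * α ≡ ι δ → (T : Subset) → (InOrbit α T ⇔ InFamily α T)
lemma3p6 α α² T = mk⇔ orbit⇒family family⇒orbit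
  where
  family⇒orbit : InFamily α T → InOrbit α T
  family⇒orbit (s , γ , s∈S , T≐) = s , γ , Gal-id , s∈S , T≐
  orbit⇒family : InOrbit α T → InFamily α T
  orbit⇒family (a , b , v , a∈S , T≐) = Sum.[ from-id , from-conj ] (σ≗id⊎σ≗conj v)
    where
    from-id : (∀ x → σ v x ≡ x) → InFamily α T
    from-id σ≗id = a , b , a∈S , ≐-trans T≐ (image-cong λ {c} _ → cong (affine a b) (σ≗id c))
    from-conj : (∀ x → σ v x ≡ conj x) → InFamily α T
    from-conj σ≗conj = a * - 𝟙 , a * lit 4 + b , S-*-𝟙 a∈S ,
      ≐-trans T≐ (≐-trans (image-cong λ {c} _ → cong (affine a b) (σ≗conj c))
                          (conj-image-CB α α² a b))
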